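{- There exists a $5$-uniform hypergraph $\mathcal{H}$ that has no polychromatic $3$-coloring, but all the $3$-heavy restricted subhypergraphs of $\mathcal{H}$ are $2$-colorable. Consequently, for the hereditary family $\mathcal{F}$ consisting of all restricted subhypergraphs of $\mathcal{H}$, we have $m_3(\mathcal{F})=6$ and $m_2(\mathcal{F})=3$.
   Context: A hypergraph $\mathcal{H}=(V,E)$ consists of a finite vertex set $V$ and a collection $E$ of subsets of $V$ (edges). It is $m$-uniform if all edges have size exactly $m$, and $m$-heavy if all edges have size at least $m$. $\mathcal{H}'=(V',E')$ is a subhypergraph of $\mathcal{H}=(V,E)$ if $V'\subset V$ and $E'\subset E$. For $X\subset V$, the trace (restriction) of $\mathcal{H}$ on $X$ is $\mathcal{H}[X]=(X,\{e\cap X: e\in E\})$. A restricted subhypergraph of $\mathcal{H}$ is a subhypergraph of some trace of $\mathcal{H}$. A family of hypergraphs is hereditary if it is closed under taking subhypergraphs and traces. A $k$-coloring of the vertices of a hypergraph is polychromatic if every edge contains a vertex of each of the $k$ colors; a hypergraph is $2$-colorable if it has a polychromatic $2$-coloring. For a family $\mathcal{F}$ of hypergraphs, $m_k(\mathcal{F})$ is the least $m$ such that every $m$-heavy hypergraph in $\mathcal{F}$ has a polychromatic $k$-coloring, and $m_k(\mathcal{F})=\infty$ if no such $m$ exists. -}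

module Defs where

open import Data.Nat using (ℕ; _≤_)
open import Data.Fin using (Fin)
open import Data.Fin.Subset using (Subset; _∈_; _⊆_; _∩_; ∣_∣)
open import Data.List using (List; map)
open import Data.List.Relation.Unary.All using (All)
open import Data.List.Relation.Unary.Any using (Any)
open import Data.Product using (Σ; ∃; _×_)
open import Relation.Binary.PropositionalEquality using (_≡_)

record Hypergraph (n : ℕ) : Set where
  field
    V  : Subset n
    E  : List (Subset n)
    wf : All (λ e → e ⊆ V) E
open Hypergraph public

_∈ₑ_ : {n : ℕ} → Subset n → List (Subset n) → Set
e ∈ₑ es = Any (e ≡_) es

Uniform : {n : ℕ} → ℕ → Hypergraph n → Set
Uniform m H = All (λ e → ∣ e ∣ ≡ m) (E H)

Heavy : {n : ℕ} → ℕ → Hypergraph n → Set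
Heavy m H = All (λ e → m ≤ ∣ e ∣) (E H)

Polychromatic : {n : ℕ} (k : ℕ) → Hypergraph n → (Fin n → Fin k) → Set
Polychromatic k H c = All (λ e → (i : Fin k) → ∃ λ x → x ∈ e × c x ≡ i) (E H)

PolyColorable : {n : ℕ} → ℕ → Hypergraph n → Set
PolyColorable k H = Σ (_ → Fin k) (Polychromatic k H)

-- G is a restricted subhypergraph of H: a subhypergraph of the trace H[X]
-- for some X ⊆ V(H).
RestrictedSub : {n : ℕ} → Hypergraph n → Hypergraph n → Set
RestrictedSub G H =
  ∃ λ X → X ⊆ V H × V G ⊆ X × All (λ e → e ∈ₑ map (_∩ X) (E H)) (E G)

Family : ℕ → Set₁
Family n = Hypergraph n → Set

HeavyColorable : {n : ℕ} → Family n → ℕ → ℕ → Set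
HeavyColorable F k m = ∀ G → F G → Heavy m G → PolyColorable k G

-- m_k(F) = m : m is the least such number (in particular m_k(F) is finite)
MkEq : {n : ℕ} → Family n → ℕ → ℕ → Set
MkEq F k m = HeavyColorable F k m × (∀ m′ → HeavyColorable F k m′ → m ≤ m′)

-- If G ⊆ H[X] is an m-heavy restricted subhypergraph, every edge of G is an
-- m-heavy trace e ∩ X of an edge e of H, so a polychromatic coloring of these
-- heavy traces also colors G.  For a fixed 5-uniform H on 8 vertices this
-- reduces the third claim to the 2^8 sets X, settled by exhaustive search like
-- the absence of a polychromatic 3-coloring of H.  Then m₃ = 6 because H itself
-- is 5-heavy while traces of 5-sets never have 6 elements, and m₂ = 3 because
-- the 2-heavy trace of H on {0, 1, 2} contains a triangle.
module Submission where

open import Defs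
open import Level using (0ℓ)
open import Data.Nat using (ℕ; zero; suc; _≤_; _<_; _≤?_) renaming (_≟_ to _≟ℕ_)
open import Data.Nat.Properties using (≤-trans; ≤-reflexive; ≰⇒>; <⇒≱)
open import Data.Fin using (Fin; zero; suc; _≟_; #_)
open import Data.Fin.Properties using (any?; all?)
open import Data.Fin.Subset using (Subset; _∈_; _⊆_; _∩_; _∪_; ∣_∣; ⊤; ⊥; ⁅_⁆)
open import Data.Fin.Subset.Properties
  using (_∈?_; anySubset?; ⊆⊤; ⊆-refl; ⊆-antisym; p∩q⊆p; p∩q⊆q; x∈p∩q⁺; p⊆q⇒∣p∣≤∣q∣)
open import Data.Vec.Functional using () renaming (_∷_ to _◂_)
open import Data.List using (List; []; _∷_; map; filter; foldr)
open import Data.List.Relation.Unary.All as All using (All)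
open import Data.List.Relation.Unary.All.Properties using (all-filter; filter⁺; map⁺)
open import Data.List.Membership.Propositional.Properties using (∈-map⁺; ∈-map⁻; ∈-filter⁺; ∈-filter⁻)
open import Data.Product using (Σ; ∃; _×_; _,_; proj₁)
open import Data.Empty using (⊥-elim)
open import Function using (_∘_; mk⇔)
open import Relation.Nullary using (¬_; Dec; yes; no)
open import Relation.Nullary.Decidable using (_×-dec_; ¬?; decidable-stable; from-yes; from-no)
import Relation.Nullary.Decidable as Dec
open import Relation.Unary using (Pred; Decidable)
open import Relation.Binary.Definitions using (_Respects_)
open import Relation.Binary.PropositionalEquality using (_≡_; refl; sym; trans; subst; _≗_)

private variable
  n k m m′ : ℕ

Rainbow : (k : ℕ) → (Fin n → Fin k) → Subset n → Set
Rainbow k c e = (i : Fin k) → ∃ λ x → x ∈ e × c x ≡ i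

-- Without function extensionality a witness c is only found up to ≗, as the
-- table c zero ◂ c ∘ suc; hence P must respect ≗.
anyFunction? : {P : Pred (Fin n → Fin k) 0ℓ} → P Respects _≗_ → Decidable P → Dec (∃ P)
anyFunction? {zero} resp P? with P? (λ ())
... | yes p = yes (_ , p)
... | no ¬p = no λ (c , p) → ¬p (resp (λ ()) p)
anyFunction? {suc n} {P = P} resp P? =
  Dec.map (mk⇔ cons uncons)
    (any? λ a → anyFunction? (resp ∘ ◂-cong) (P? ∘ (a ◂_)))
  where
  ◂-cong : ∀ {a} {f g : Fin n → Fin _} → f ≗ g → (a ◂ f) ≗ (a ◂ g)
  ◂-cong f≗g zero    = refl
  ◂-cong f≗g (suc x) = f≗g x

  ◂-η : (c : Fin (suc n) → Fin _) → c ≗ (c zero ◂ c ∘ suc)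
  ◂-η c zero    = refl
  ◂-η c (suc x) = refl

  cons : (∃ λ a → ∃ λ f → P (a ◂ f)) → ∃ P
  cons (a , f , p) = a ◂ f , p

  uncons : ∃ P → ∃ λ a → ∃ λ f → P (a ◂ f)
  uncons (c , p) = c zero , c ∘ suc , resp (◂-η c) p

allSubset? : {P : Pred (Subset n) 0ℓ} → Decidable P → Dec (∀ X → P X)
allSubset? P? with anySubset? (¬? ∘ P?)
... | yes (X , ¬p) = no λ ∀p → ¬p (∀p X)
... | no ¬∃¬p      = yes λ X → decidable-stable (P? X) λ ¬p → ¬∃¬p (X , ¬p)

rainbow? : (c : Fin n → Fin k) → Decidable (Rainbow k c)
rainbow? c e = all? λ i → any? λ x → (x ∈? e) ×-dec (c x ≟ i)

Rainbow-resp-≗ : {e : Subset n} → (λ c → Rainbow k c e) Respects _≗_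
Rainbow-resp-≗ c≗d rainbow i with rainbow i
... | x , x∈e , cx≡i = x , x∈e , trans (sym (c≗d x)) cx≡i

polyColorable? : (k : ℕ) (H : Hypergraph n) → Dec (PolyColorable k H)
polyColorable? k H =
  anyFunction? (λ c≗d → All.map (Rainbow-resp-≗ c≗d)) (λ c → All.all? (rainbow? c) (E H))

Heavy-anti : m′ ≤ m → (G : Hypergraph n) → Heavy m G → Heavy m′ G
Heavy-anti m′≤m G = All.map (≤-trans m′≤m)

Uniform⇒Heavy : (H : Hypergraph n) → Uniform m H → Heavy m H
Uniform⇒Heavy H = All.map (≤-reflexive ∘ sym)

Polychromatic-anti : (G G′ : Hypergraph n) {c : Fin n → Fin k} →
                     All (_∈ₑ E G′) (E G) → Polychromatic k G′ c → Polychromatic k G c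
Polychromatic-anti G G′ G⊆G′ poly = All.map (All.lookup poly) G⊆G′

⊆⇒∩≡ : {p q : Subset n} → p ⊆ q → p ∩ q ≡ p
⊆⇒∩≡ {p = p} {q} p⊆q = ⊆-antisym (p∩q⊆p p q) (λ x∈p → x∈p∩q⁺ (x∈p , p⊆q x∈p))

restrictedSub-refl : (H : Hypergraph n) → RestrictedSub H H
restrictedSub-refl H = V H , ⊆-refl , ⊆-refl , All.tabulate e∈trace
  where
  e∈trace : ∀ {e} → e ∈ₑ E H → e ∈ₑ map (_∩ V H) (E H)
  e∈trace e∈E = subst (_∈ₑ map (_∩ V H) (E H)) (⊆⇒∩≡ (All.lookup (wf H) e∈E)) (∈-map⁺ _ e∈E)

heavyTrace : ℕ → Hypergraph n → Subset n → Hypergraph n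
heavyTrace m H X = record
  { V  = X
  ; E  = filter (λ e → m ≤? ∣ e ∣) (map (_∩ X) (E H))
  ; wf = filter⁺ _ (map⁺ (All.universal (λ e {x} → p∩q⊆q e X {x}) (E H)))
  }

heavyTrace-heavy : (H : Hypergraph n) (X : Subset n) → Heavy m (heavyTrace m H X)
heavyTrace-heavy {m = m} H X = all-filter (λ e → m ≤? ∣ e ∣) (map (_∩ X) (E H))

heavyTrace-restrictedSub : (H : Hypergraph n) {X : Subset n} → X ⊆ V H →
                           RestrictedSub (heavyTrace m H X) H
heavyTrace-restrictedSub {m = m} H X⊆V =
  _ , X⊆V , ⊆-refl , All.tabulate (proj₁ ∘ ∈-filter⁻ (λ e → m ≤? ∣ e ∣))

restrictedSub⊆heavyTrace : (H G : Hypergraph n) (X : Subset n) →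
                           All (_∈ₑ map (_∩ X) (E H)) (E G) → Heavy m G →
                           All (_∈ₑ E (heavyTrace m H X)) (E G)
restrictedSub⊆heavyTrace {m = m} H G X G⊆trace heavy =
  All.zipWith (λ (g∈trace , m≤∣g∣) → ∈-filter⁺ (λ e → m ≤? ∣ e ∣) g∈trace m≤∣g∣) (G⊆trace , heavy)

heavyTraces⇒HeavyColorable : (H : Hypergraph n) →
                             (∀ X → X ⊆ V H → PolyColorable k (heavyTrace m H X)) →
                             HeavyColorable (λ G → RestrictedSub G H) k m
heavyTraces⇒HeavyColorable H colorable G (X , X⊆V , _ , G⊆trace) heavy
  with colorable X X⊆V
... | c , poly = c , Polychromatic-anti G (heavyTrace _ H X)
                       (restrictedSub⊆heavyTrace H G X G⊆trace heavy) poly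

restrictedSub-edge-≤ : (H G : Hypergraph n) → Uniform m H → RestrictedSub G H →
                       All (λ g → ∣ g ∣ ≤ m) (E G)
restrictedSub-edge-≤ H G uniform (X , _ , _ , G⊆trace) = All.map trace-≤ G⊆trace
  where
  trace-≤ : ∀ {g} → g ∈ₑ map (_∩ X) (E H) → ∣ g ∣ ≤ _
  trace-≤ g∈trace with ∈-map⁻ _ g∈trace
  ... | e , e∈E , refl =
    ≤-trans (p⊆q⇒∣p∣≤∣q∣ (p∩q⊆p e X)) (≤-reflexive (All.lookup uniform e∈E))

Uniform⇒HeavyColorable-suc : (H : Hypergraph n) → Uniform m H →
                             HeavyColorable (λ G → RestrictedSub G H) (suc k) (suc m)
Uniform⇒HeavyColorable-suc H uniform G sub heavy =
  (λ _ → zero) ,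
  All.zipWith (λ (m<∣g∣ , ∣g∣≤m) → ⊥-elim (<⇒≱ m<∣g∣ ∣g∣≤m))
    (heavy , restrictedSub-edge-≤ H G uniform sub)

nonColorable⇒< : {F : Family n} (G : Hypergraph n) → F G → Heavy m G → ¬ PolyColorable k G →
                 HeavyColorable F k m′ → m < m′
nonColorable⇒< G FG heavy ¬colorable colorable =
  ≰⇒> λ m′≤m → ¬colorable (colorable G FG (Heavy-anti m′≤m G heavy))

vertices : List (Fin n) → Subset n
vertices = foldr (λ x s → ⁅ x ⁆ ∪ s) ⊥

H : Hypergraph 8
H = record
  { V  = ⊤
  ; E  = map vertices
           ( (# 0 ∷ # 1 ∷ # 3 ∷ # 6 ∷ # 7 ∷ [])
           ∷ (# 0 ∷ # 1 ∷ # 2 ∷ # 4 ∷ # 5 ∷ [])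
           ∷ (# 2 ∷ # 4 ∷ # 5 ∷ # 6 ∷ # 7 ∷ [])
           ∷ (# 0 ∷ # 2 ∷ # 3 ∷ # 4 ∷ # 6 ∷ [])
           ∷ (# 0 ∷ # 3 ∷ # 4 ∷ # 5 ∷ # 7 ∷ [])
           ∷ (# 1 ∷ # 3 ∷ # 4 ∷ # 5 ∷ # 6 ∷ [])
           ∷ (# 1 ∷ # 2 ∷ # 3 ∷ # 4 ∷ # 7 ∷ [])
           ∷ (# 0 ∷ # 1 ∷ # 4 ∷ # 6 ∷ # 7 ∷ [])
           ∷ (# 0 ∷ # 1 ∷ # 2 ∷ # 5 ∷ # 6 ∷ [])
           ∷ (# 0 ∷ # 2 ∷ # 3 ∷ # 5 ∷ # 7 ∷ [])
           ∷ (# 1 ∷ # 3 ∷ # 5 ∷ # 6 ∷ # 7 ∷ [])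
           ∷ [])
  ; wf = All.universal (λ _ {x} → ⊆⊤ {x = x}) _
  }

H-uniform : Uniform 5 H
H-uniform = from-yes (All.all? (λ e → ∣ e ∣ ≟ℕ 5) (E H))

H-¬3-colorable : ¬ PolyColorable 3 H
H-¬3-colorable = from-no (polyColorable? 3 H)

H-heavyTraces-2-colorable : ∀ X → PolyColorable 2 (heavyTrace 3 H X)
H-heavyTraces-2-colorable = from-yes (allSubset? λ X → polyColorable? 2 (heavyTrace 3 H X))

triangle : Subset 8
triangle = vertices (# 0 ∷ # 1 ∷ # 2 ∷ [])

H-triangle-¬2-colorable : ¬ PolyColorable 2 (heavyTrace 2 H triangle)
H-triangle-¬2-colorable = from-no (polyColorable? 2 (heavyTrace 2 H triangle))

theorem3 : Σ ℕ λ n → Σ (Hypergraph n) λ H →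
               Uniform 5 H
             × ¬ PolyColorable 3 H
             × (∀ G → RestrictedSub G H → Heavy 3 G → PolyColorable 2 G)
             × MkEq (λ G → RestrictedSub G H) 3 6
             × MkEq (λ G → RestrictedSub G H) 2 3
theorem3 =
  8 , H , H-uniform , H-¬3-colorable , m₂≤3 ,
  (Uniform⇒HeavyColorable-suc H H-uniform ,
   λ _ → nonColorable⇒< H (restrictedSub-refl H) (Uniform⇒Heavy H H-uniform) H-¬3-colorable) ,
  (m₂≤3 ,
   λ _ → nonColorable⇒< (heavyTrace 2 H triangle) (heavyTrace-restrictedSub {m = 2} H ⊆⊤)
           (heavyTrace-heavy H triangle) H-triangle-¬2-colorable)
  where
  m₂≤3 : HeavyColorable (λ G → RestrictedSub G H) 2 3
  m₂≤3 = heavyTraces⇒HeavyColorable H λ X _ → H-heavyTraces-2-colorable X
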